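{- For any linearly ordered Routley IM, any state $s$ in it, and all $L$-formulas $\alpha,\beta$: $s\Vdash\alpha\vee\beta$ iff $s\Vdash\alpha$ or $s\Vdash\beta$.
   Context: Let $L$ be the set of formulas built from a set $At$ of atomic formulas with $\wedge,\vee,\neg$. A Routley IF is a structure $\langle S,\circ,*,i,e\rangle$ where $S$ is a nonempty set, $\circ$ is an associative, commutative, idempotent binary operation on $S$, $*:S\to S$, and $i\neq e$ are elements of $S$ such that: $s\circ i=s$ and $s\circ e=e$ for all $s$; if $e=t\circ u$ then $e=t$ or $e=u$; and, writing $s\le t$ iff $s\circ t=s$: $i^*=e$ and $e^*=i$; $t\le u$ implies $u^*\le t^*$; for all $t,u$, $(t\circ u)^*\le t^*$ or $(t\circ u)^*\le u^*$. A proper filter is $F\subseteq S$ with $i\in F$, $e\notin F$, and $t\circ u\in F$ iff $t\in F$ and $u\in F$. A Routley IM is a Routley IF with a valuation $V$ assigning a proper filter to each atom; it is linearly ordered if $\le$ is a linear order on $S$. Support: $s\Vdash p$ iff $s\in V(p)$; $s\Vdash\alpha\wedge\beta$ iff $s\Vdash\alpha$ and $s\Vdash\beta$; $s\Vdash\alpha\vee\beta$ iff there are $t,u$ with $t\Vdash\alpha$, $u\Vdash\beta$, $t\circ u\le s$; $s\Vdash\neg\alpha$ iff $s^*\nVdash\alpha$. -}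

module Defs where

open import Data.Product using (Σ; ∃; _×_; _,_)
open import Data.Sum using (_⊎_)
open import Relation.Nullary using (¬_)
open import Relation.Binary.PropositionalEquality using (_≡_)

data Form (At : Set) : Set where
  atom : At → Form At
  _∧'_ : Form At → Form At → Form At
  _∨'_ : Form At → Form At → Form At
  ¬'_  : Form At → Form At

record RoutleyIF : Set₁ where
  field
    S     : Set
    _∘_   : S → S → S
    _*    : S → S
    i     : S
    e     : S
    ∘-assoc : ∀ s t u → (s ∘ t) ∘ u ≡ s ∘ (t ∘ u)
    ∘-comm  : ∀ s t → s ∘ t ≡ t ∘ s
    ∘-idem  : ∀ s → s ∘ s ≡ s
    i≢e     : ¬ (i ≡ e)
    ∘-i     : ∀ s → s ∘ i ≡ s
    ∘-e     : ∀ s → s ∘ e ≡ e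
    e-prime : ∀ t u → e ≡ t ∘ u → (e ≡ t) ⊎ (e ≡ u)

  _≤_ : S → S → Set
  s ≤ t = s ∘ t ≡ s

  field
    i*≡e    : i * ≡ e
    e*≡i    : e * ≡ i
    *-anti  : ∀ t u → t ≤ u → (u *) ≤ (t *)
    *-∘     : ∀ t u → (((t ∘ u) *) ≤ (t *)) ⊎ (((t ∘ u) *) ≤ (u *))

  record ProperFilter (F : S → Set) : Set where
    field
      i∈F : F i
      e∉F : ¬ F e
      ∘∈F : ∀ t u → (F (t ∘ u) → F t × F u) × (F t × F u → F (t ∘ u))

record RoutleyIM (At : Set) : Set₁ where
  field
    frame : RoutleyIF
  open RoutleyIF frame public
  field
    V        : At → S → Set
    V-filter : ∀ p → ProperFilter (V p)

-- linearly ordered: ≤ is a linear (total) order on S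
-- (reflexivity, antisymmetry, transitivity already follow from the semilattice laws).
LinearlyOrdered : ∀ {At} → RoutleyIM At → Set
LinearlyOrdered M = ∀ s t → (s ≤ t) ⊎ (t ≤ s)
  where open RoutleyIM M

module _ {At : Set} (M : RoutleyIM At) where
  open RoutleyIM M

  _⊩_ : S → Form At → Set
  s ⊩ atom p   = V p s
  s ⊩ (α ∧' β) = (s ⊩ α) × (s ⊩ β)
  s ⊩ (α ∨' β) = Σ S λ t → Σ S λ u → (t ⊩ α) × (u ⊩ β) × ((t ∘ u) ≤ s)
  s ⊩ (¬' α)   = ¬ ((s *) ⊩ α)

-- Support is persistent upward along ≤, and the top state i supports every formula.
-- So s ⊩ α gives s ⊩ α ∨ β via the pair (s, i). Conversely, in a linear order t ∘ u
-- is one of t and u, so a witness pair (t, u) with t ∘ u ≤ s puts the corresponding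
-- disjunct at a state below s, and persistence lifts it to s.
module Submission where

open import Defs
open import Data.Product using (_×_; _,_; proj₁; proj₂)
open import Data.Sum using (_⊎_; inj₁; inj₂; [_,_])
open import Function.Bundles using (_⇔_; mk⇔)
open import Relation.Binary.PropositionalEquality using (_≡_; sym; trans; cong; subst; module ≡-Reasoning)
open import Relation.Nullary using (¬_)

module _ {At : Set} (M : RoutleyIM At) where
  open RoutleyIM M
  open ProperFilter

  ≤-refl : ∀ s → s ≤ s
  ≤-refl = ∘-idem

  ≤-trans : ∀ {s t u} → s ≤ t → t ≤ u → s ≤ u
  ≤-trans {s} {t} {u} s≤t t≤u = begin
    s ∘ u        ≡⟨ cong (_∘ u) (sym s≤t) ⟩
    (s ∘ t) ∘ u  ≡⟨ ∘-assoc s t u ⟩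
    s ∘ (t ∘ u)  ≡⟨ cong (s ∘_) t≤u ⟩
    s ∘ t        ≡⟨ s≤t ⟩
    s            ∎
    where open ≡-Reasoning

  ∘-i-≤ : ∀ s → (s ∘ i) ≤ s
  ∘-i-≤ s = subst (_≤ s) (sym (∘-i s)) (≤-refl s)

  i-∘-≤ : ∀ s → (i ∘ s) ≤ s
  i-∘-≤ s = subst (_≤ s) (∘-comm s i) (∘-i-≤ s)

  ⊩-mono : ∀ α {s t} → s ≤ t → _⊩_ M s α → _⊩_ M t α
  ⊩-mono (atom p) {s} {t} s≤t s⊩p =
    proj₂ (proj₁ (∘∈F (V-filter p) s t) (subst (V p) (sym s≤t) s⊩p))
  ⊩-mono (α ∧' β) s≤t (s⊩α , s⊩β) = ⊩-mono α s≤t s⊩α , ⊩-mono β s≤t s⊩β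
  ⊩-mono (α ∨' β) s≤t (u , v , u⊩α , v⊩β , uv≤s) = u , v , u⊩α , v⊩β , ≤-trans uv≤s s≤t
  ⊩-mono (¬' α) {s} {t} s≤t s*⊮α t*⊩α = s*⊮α (⊩-mono α (*-anti s t s≤t) t*⊩α)

  -- The two halves must be proved together: each is needed for the other at ¬.
  i⊩×e⊮ : ∀ α → _⊩_ M i α × ¬ _⊩_ M e α
  i⊩×e⊮ (atom p) = i∈F (V-filter p) , e∉F (V-filter p)
  i⊩×e⊮ (α ∧' β) = (proj₁ (i⊩×e⊮ α) , proj₁ (i⊩×e⊮ β)) , λ e⊩α∧β → proj₂ (i⊩×e⊮ α) (proj₁ e⊩α∧β)
  i⊩×e⊮ (α ∨' β) = (i , i , proj₁ (i⊩×e⊮ α) , proj₁ (i⊩×e⊮ β) , ∘-i-≤ i) , e⊮α∨β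
    where
    e⊮α∨β : ¬ _⊩_ M e (α ∨' β)
    e⊮α∨β (t , u , t⊩α , u⊩β , tu≤e) with e-prime t u (trans (sym (∘-e (t ∘ u))) tu≤e)
    ... | inj₁ e≡t = proj₂ (i⊩×e⊮ α) (subst (λ s → _⊩_ M s α) (sym e≡t) t⊩α)
    ... | inj₂ e≡u = proj₂ (i⊩×e⊮ β) (subst (λ s → _⊩_ M s β) (sym e≡u) u⊩β)
  i⊩×e⊮ (¬' α) = (λ i*⊩α → proj₂ (i⊩×e⊮ α) (subst (λ s → _⊩_ M s α) i*≡e i*⊩α))
               , λ e*⊮α → e*⊮α (subst (λ s → _⊩_ M s α) (sym e*≡i) (proj₁ (i⊩×e⊮ α)))

  i⊩ : ∀ α → _⊩_ M i α
  i⊩ α = proj₁ (i⊩×e⊮ α)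

  ∨-introˡ : ∀ {s} α β → _⊩_ M s α → _⊩_ M s (α ∨' β)
  ∨-introˡ {s} α β s⊩α = s , i , s⊩α , i⊩ β , ∘-i-≤ s

  ∨-introʳ : ∀ {s} α β → _⊩_ M s β → _⊩_ M s (α ∨' β)
  ∨-introʳ {s} α β s⊩β = i , s , i⊩ α , s⊩β , i-∘-≤ s

  module _ (linear : LinearlyOrdered M) where

    ∘-selective : ∀ t u → t ∘ u ≡ t ⊎ t ∘ u ≡ u
    ∘-selective t u with linear t u
    ... | inj₁ t≤u = inj₁ t≤u
    ... | inj₂ u≤t = inj₂ (trans (∘-comm t u) u≤t)

    ∨-elim : ∀ {s} α β → _⊩_ M s (α ∨' β) → _⊩_ M s α ⊎ _⊩_ M s β
    ∨-elim {s} α β (t , u , t⊩α , u⊩β , tu≤s) with ∘-selective t u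
    ... | inj₁ tu≡t = inj₁ (⊩-mono α (subst (_≤ s) tu≡t tu≤s) t⊩α)
    ... | inj₂ tu≡u = inj₂ (⊩-mono β (subst (_≤ s) tu≡u tu≤s) u⊩β)

proposition7 : {At : Set} (M : RoutleyIM At) → LinearlyOrdered M →
    (s : RoutleyIM.S M) (α β : Form At) →
    (_⊩_ M s (α ∨' β)) ⇔ ((_⊩_ M s α) ⊎ (_⊩_ M s β))
proposition7 M linear s α β =
  mk⇔ (∨-elim M linear α β) [ ∨-introˡ M α β , ∨-introʳ M α β ]
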